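{- Let $\sigma^{:}$ and $\pi^{:}$ be decorated permutations on $[n]$ with Grassmann necklaces $I^{\sigma},I^{\pi}$ and Grassmann intervals $S^{\sigma}_i,S^{\pi}_i$. Then $I^{\sigma}_i\subseteq I^{\pi}_i$ for all $i\in[n]$ if and only if $S^{\sigma}_i\subseteq S^{\pi}_i$ for all $i\in[n]$.
   Context: For $i\in[n]$ the cyclic order $<_i$ is $i<_i i+1<_i\cdots<_i n<_i 1<_i\cdots<_i i-1$. A decorated permutation on $[n]$ is a pair $(\pi,\operatorname{col})$, $\pi$ a permutation of $[n]$, $\operatorname{col}:[n]\to\{0,1,-1\}$ with $\operatorname{col}(i)=0$ iff $\pi(i)\ne i$. Its Grassmann necklace is $I_i=\{j: j<_i\pi^{ -1}(j)\text{ or }\operatorname{col}(j)=-1\}$. For $a,b\in[n]$ the cyclic interval $(a,b]$ is $\{a+1,\dots,b\}$ (indices mod $n$), with $(a,a]=\emptyset$. The Grassmann interval is $S^{\pi}_i=(\pi^{ -1}(i),i]$, except $S^{\pi}_i=[n]$ when $\pi(i)=i$ and $\operatorname{col}(i)=-1$. -}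

module Defs where

open import Data.Nat using (ℕ; zero; suc; _+_; _∸_; _<_; _≤_; _≤ᵇ_)
open import Data.Bool using (if_then_else_)
open import Data.Fin using (Fin; toℕ)
open import Data.Product using (_×_)
open import Data.Sum using (_⊎_)
open import Function.Bundles using (_↔_; Inverse)
open import Relation.Binary.PropositionalEquality using (_≡_; _≢_)
open import Relation.Nullary using (¬_)

-- [n] is modelled as Fin n (element k of Fin n stands for k+1 ∈ [n]).

data Col : Set where
  c0 c1 cm1 : Col

record DecPerm (n : ℕ) : Set where
  field
    perm    : Fin n ↔ Fin n
    col     : Fin n → Col
    col-spec : ∀ i → (col i ≡ c0 → Inverse.to perm i ≢ i)
                   × (Inverse.to perm i ≢ i → col i ≡ c0)

  π : Fin n → Fin n
  π = Inverse.to perm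

  π⁻¹ : Fin n → Fin n
  π⁻¹ = Inverse.from perm

open DecPerm public

offset : ∀ {n} → Fin n → Fin n → ℕ
offset {n} i j =
  if toℕ i ≤ᵇ toℕ j then toℕ j ∸ toℕ i else (toℕ j + n) ∸ toℕ i

_<[_]_ : ∀ {n} → Fin n → Fin n → Fin n → Set
a <[ i ] b = offset i a < offset i b

-- cyclic interval (a, b] = {a+1, ..., b}; (a, a] = ∅
_∈⟨_,_] : ∀ {n} → Fin n → Fin n → Fin n → Set
j ∈⟨ a , b ] = (0 < offset a j) × (offset a j ≤ offset a b)

_∈Necklace[_]_ : ∀ {n} → Fin n → DecPerm n → Fin n → Set
j ∈Necklace[ P ] i = (j <[ i ] π⁻¹ P j) ⊎ (col P j ≡ cm1)

_∈GrInterval[_]_ : ∀ {n} → Fin n → DecPerm n → Fin n → Set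
j ∈GrInterval[ P ] i =
  ((π P i ≡ i) × (col P i ≡ cm1)) ⊎
  (¬ ((π P i ≡ i) × (col P i ≡ cm1)) × (j ∈⟨ π⁻¹ P i , i ]))

-- Both conditions are the same relation read in two directions: j ∈ I_i holds
-- exactly when i ∈ S_j.  For the non-exceptional members this is the circle
-- fact "j comes before π⁻¹(j) when starting from i iff i lies on the arc
-- (π⁻¹(j), j]"; both sides say that j lies on the half-open arc [i, π⁻¹(j)).
-- The exceptional members match because col(j) = -1 forces π(j) = j.
module Submission where

open import Defs
open import Data.Bool using (true; false; if_then_else_)
open import Data.Empty using (⊥-elim)
open import Data.Fin using (Fin; toℕ; _≟_)
open import Data.Fin.Properties using (toℕ<n)
open import Data.Nat using (ℕ; _+_; _<_; _≤_; _≤ᵇ_)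
open import Data.Nat.Properties hiding (_≟_)
open import Data.Product using (_×_; _,_; proj₂)
open import Data.Product.Function.NonDependent.Propositional using (_×-⇔_)
open import Data.Sum using (_⊎_; inj₁; inj₂)
open import Function using (_∘_)
open import Function.Bundles using (_⇔_; mk⇔; Equivalence)
import Function.Properties.Equivalence as ⇔
open import Relation.Binary.PropositionalEquality using (_≡_; _≢_; refl; sym; trans)
open import Relation.Nullary using (Dec; yes; no)
open import Relation.Nullary.Reflects using (ofʸ; ofⁿ)
open import Relation.Nullary.Decidable using (decidable-stable)

-- lift n a b is the representative of b in [a, a + n).
lift : ℕ → ℕ → ℕ → ℕ
lift n a b = if a ≤ᵇ b then b else b + n

offset+≡lift : ∀ {n} (a b : Fin n) → offset a b + toℕ a ≡ lift n (toℕ a) (toℕ b)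
offset+≡lift {n} a b with toℕ a ≤ᵇ toℕ b | ≤ᵇ-reflects-≤ (toℕ a) (toℕ b)
... | true  | ofʸ a≤b = m∸n+n≡m a≤b
... | false | ofⁿ _   = m∸n+n≡m (≤-trans (<⇒≤ (toℕ<n a)) (m≤n+m n (toℕ b)))

<-via-+ : ∀ {k x y X Y} → x + k ≡ X → y + k ≡ Y → (x < y) ⇔ (X < Y)
<-via-+ {k} refl refl = mk⇔ (+-monoˡ-< k) (+-cancelʳ-< k _ _)

≤-via-+ : ∀ {k x y X Y} → x + k ≡ X → y + k ≡ Y → (x ≤ y) ⇔ (X ≤ Y)
≤-via-+ {k} refl refl = mk⇔ (+-monoˡ-≤ k) (+-cancelʳ-≤ k _ _)

-- b lies on the cyclic arc running from a (included) to c (excluded).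
_∈[_,_⟩ : ℕ → ℕ → ℕ → Set
b ∈[ a , c ⟩ = (a ≤ b × b < c) ⊎ (b < c × c < a) ⊎ (c < a × a ≤ b)

lift-<-lift⇔∈arc : ∀ {n} a {b c} → b < n → c < n → (lift n a b < lift n a c) ⇔ (b ∈[ a , c ⟩)
lift-<-lift⇔∈arc {n} a {b} {c} b<n c<n
  with a ≤ᵇ b | ≤ᵇ-reflects-≤ a b | a ≤ᵇ c | ≤ᵇ-reflects-≤ a c
... | true | ofʸ a≤b | true | ofʸ a≤c = mk⇔ (λ b<c → inj₁ (a≤b , b<c)) from
  where
  from : b ∈[ a , c ⟩ → b < c
  from (inj₁ (_ , b<c))        = b<c
  from (inj₂ (inj₁ (_ , c<a))) = ⊥-elim (<⇒≱ c<a a≤c)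
  from (inj₂ (inj₂ (c<a , _))) = ⊥-elim (<⇒≱ c<a a≤c)
... | true | ofʸ a≤b | false | ofⁿ a≰c =
  mk⇔ (λ _ → inj₂ (inj₂ (≰⇒> a≰c , a≤b))) (λ _ → <-≤-trans b<n (m≤n+m n c))
... | false | ofⁿ a≰b | true | ofʸ a≤c = mk⇔ to from
  where
  to : b + n < c → b ∈[ a , c ⟩
  to b+n<c = ⊥-elim (<-asym c<n (≤-<-trans (m≤n+m n b) b+n<c))
  from : b ∈[ a , c ⟩ → b + n < c
  from (inj₁ (a≤b , _))        = ⊥-elim (a≰b a≤b)
  from (inj₂ (inj₁ (_ , c<a))) = ⊥-elim (<⇒≱ c<a a≤c)
  from (inj₂ (inj₂ (c<a , _))) = ⊥-elim (<⇒≱ c<a a≤c)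
... | false | ofⁿ a≰b | false | ofⁿ a≰c =
  mk⇔ (λ b+n<c+n → inj₂ (inj₁ (+-cancelʳ-< n b c b+n<c+n , ≰⇒> a≰c))) from
  where
  from : b ∈[ a , c ⟩ → b + n < c + n
  from (inj₁ (a≤b , _))        = ⊥-elim (a≰b a≤b)
  from (inj₂ (inj₁ (b<c , _))) = +-monoˡ-< n b<c
  from (inj₂ (inj₂ (_ , a≤b))) = ⊥-elim (a≰b a≤b)

lift-between⇔∈arc : ∀ {n a b c} → a < n → b < n → c < n →
  (a < lift n a b × lift n a b ≤ lift n a c) ⇔ (c ∈[ b , a ⟩)
lift-between⇔∈arc {n} {a} {b} {c} a<n b<n c<n
  with a ≤ᵇ b | ≤ᵇ-reflects-≤ a b | a ≤ᵇ c | ≤ᵇ-reflects-≤ a c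
... | true | ofʸ a≤b | true | ofʸ a≤c = mk⇔ (inj₂ ∘ inj₂) from
  where
  from : c ∈[ b , a ⟩ → a < b × b ≤ c
  from (inj₁ (_ , c<a))        = ⊥-elim (<⇒≱ c<a a≤c)
  from (inj₂ (inj₁ (c<a , _))) = ⊥-elim (<⇒≱ c<a a≤c)
  from (inj₂ (inj₂ a<b≤c))     = a<b≤c
... | true | ofʸ a≤b | false | ofⁿ a≰c =
  mk⇔ (λ (a<b , _) → inj₂ (inj₁ (≰⇒> a≰c , a<b))) from
  where
  from : c ∈[ b , a ⟩ → a < b × b ≤ c + n
  from (inj₁ (b≤c , c<a))        = ⊥-elim (<⇒≱ c<a (≤-trans a≤b b≤c))
  from (inj₂ (inj₁ (_ , a<b)))   = a<b , ≤-trans (<⇒≤ b<n) (m≤n+m n c)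
  from (inj₂ (inj₂ (_ , b≤c)))   = ⊥-elim (a≰c (≤-trans a≤b b≤c))
... | false | ofⁿ a≰b | true | ofʸ a≤c = mk⇔ to from
  where
  to : a < b + n × b + n ≤ c → c ∈[ b , a ⟩
  to (_ , b+n≤c) = ⊥-elim (<⇒≱ c<n (≤-trans (m≤n+m n b) b+n≤c))
  from : c ∈[ b , a ⟩ → a < b + n × b + n ≤ c
  from (inj₁ (_ , c<a))        = ⊥-elim (<⇒≱ c<a a≤c)
  from (inj₂ (inj₁ (c<a , _))) = ⊥-elim (<⇒≱ c<a a≤c)
  from (inj₂ (inj₂ (a<b , _))) = ⊥-elim (a≰b (<⇒≤ a<b))
... | false | ofⁿ a≰b | false | ofⁿ a≰c =
  mk⇔ (λ (_ , b+n≤c+n) → inj₁ (+-cancelʳ-≤ n b c b+n≤c+n , ≰⇒> a≰c)) from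
  where
  from : c ∈[ b , a ⟩ → a < b + n × b + n ≤ c + n
  from (inj₁ (b≤c , _))        = <-≤-trans a<n (m≤n+m n b) , +-monoˡ-≤ n b≤c
  from (inj₂ (inj₁ (_ , a<b))) = ⊥-elim (a≰b (<⇒≤ a<b))
  from (inj₂ (inj₂ (a<b , _))) = ⊥-elim (a≰b (<⇒≤ a<b))

<[]⇔∈arc : ∀ {n} (i j p : Fin n) → (j <[ i ] p) ⇔ (toℕ j ∈[ toℕ i , toℕ p ⟩)
<[]⇔∈arc i j p =
  ⇔.trans (<-via-+ (offset+≡lift i j) (offset+≡lift i p))
          (lift-<-lift⇔∈arc (toℕ i) (toℕ<n j) (toℕ<n p))

∈⟨]⇔∈arc : ∀ {n} (a b j : Fin n) → (j ∈⟨ a , b ]) ⇔ (toℕ b ∈[ toℕ j , toℕ a ⟩)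
∈⟨]⇔∈arc a b j =
  ⇔.trans (<-via-+ refl (offset+≡lift a j)
             ×-⇔ ≤-via-+ (offset+≡lift a j) (offset+≡lift a b))
          (lift-between⇔∈arc (toℕ<n a) (toℕ<n j) (toℕ<n b))

<[]⇔∈⟨] : ∀ {n} (i j p : Fin n) → (j <[ i ] p) ⇔ (i ∈⟨ p , j ])
<[]⇔∈⟨] i j p = ⇔.trans (<[]⇔∈arc i j p) (⇔.sym (∈⟨]⇔∈arc p j i))

_≟cm1 : (c : Col) → Dec (c ≡ cm1)
c0  ≟cm1 = no λ ()
c1  ≟cm1 = no λ ()
cm1 ≟cm1 = yes refl

cm1⇒fixed : ∀ {n} (P : DecPerm n) {j} → col P j ≡ cm1 → π P j ≡ j
cm1⇒fixed P {j} col≡cm1 = decidable-stable (π P j ≟ j) λ moved →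
  c0≢cm1 (trans (sym (proj₂ (col-spec P j) moved)) col≡cm1)
  where
  c0≢cm1 : c0 ≢ cm1
  c0≢cm1 ()

∈Necklace⇔∈GrInterval : ∀ {n} (P : DecPerm n) (i j : Fin n) →
  (j ∈Necklace[ P ] i) ⇔ (i ∈GrInterval[ P ] j)
∈Necklace⇔∈GrInterval P i j = mk⇔ to from
  where
  to : j ∈Necklace[ P ] i → i ∈GrInterval[ P ] j
  to j∈I with col P j ≟cm1
  ... | yes col≡cm1 = inj₁ (cm1⇒fixed P col≡cm1 , col≡cm1)
  to (inj₁ j<π⁻¹j)  | no col≢cm1 =
    inj₂ (col≢cm1 ∘ proj₂ , Equivalence.to (<[]⇔∈⟨] i j (π⁻¹ P j)) j<π⁻¹j)
  to (inj₂ col≡cm1) | no col≢cm1 = ⊥-elim (col≢cm1 col≡cm1)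
  from : i ∈GrInterval[ P ] j → j ∈Necklace[ P ] i
  from (inj₁ (_ , col≡cm1)) = inj₂ col≡cm1
  from (inj₂ (_ , i∈S))     = inj₁ (Equivalence.from (<[]⇔∈⟨] i j (π⁻¹ P j)) i∈S)

corollary3p10 : ∀ {n : ℕ} (σ π : DecPerm n) →
    (∀ (i j : Fin n) → j ∈Necklace[ σ ] i → j ∈Necklace[ π ] i)
    ⇔ (∀ (i j : Fin n) → j ∈GrInterval[ σ ] i → j ∈GrInterval[ π ] i)
corollary3p10 σ π = mk⇔
  (λ I⊆ i j → to (∈Necklace⇔∈GrInterval π j i) ∘ I⊆ j i
            ∘ from (∈Necklace⇔∈GrInterval σ j i))
  (λ S⊆ i j → from (∈Necklace⇔∈GrInterval π i j) ∘ S⊆ j i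
            ∘ to (∈Necklace⇔∈GrInterval σ i j))
  where open Equivalence
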